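{- If $t^2\not\equiv Dd \bmod 4$, then $\mathcal{N}_T(t,d)=0$; and if $t^2\equiv Dd\bmod 4$, then $\mathcal{N}_T(t,d)\leq r_T\left(\frac{t^2-Dd}{4}\right)$.
   Context: Let $T$ be a positive definite rational symmetric $2\times 2$ matrix written as $T=\frac{1}{M}(\begin{smallmatrix} n & r/2 \\ r/2 & m\end{smallmatrix})$ with $M$ a positive integer and $n,r,m$ coprime integers, and let $D=r^2-4nm$. Let $\mathfrak{L}_T=\{(u,v,w)\in\mathbb{Z}^3 : ru+mv+nw=0\}$ and for a positive integer $A$ let $r_T(A)=\#\{(u,v,w)\in\mathfrak{L}_T : u^2-vw=A\}$. Let $\mathrm{Sym}_2(\mathbb{Z})$ be the half-integral symmetric matrices $\sigma=(\begin{smallmatrix}\sigma_1&\sigma_0\\\sigma_0&\sigma_2\end{smallmatrix})$ with $\sigma_1,\sigma_2,2\sigma_0\in\mathbb{Z}$, and for integers $t$ and $d>0$ let $\mathcal{N}_T(t,d)=\#\{\sigma\in\mathrm{Sym}_2(\mathbb{Z}) : \sigma_1m-\sigma_0r+\sigma_2n=\tfrac{t}{2},\ \sigma_0^2-\sigma_1\sigma_2=\tfrac{d}{4}\}$. -}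

module Defs where

open import Data.Nat using (ℕ)
open import Data.Integer using (ℤ; +_; _+_; _-_; _*_; -_)
open import Data.Product using (Σ; _×_; _,_)
open import Data.Fin using (Fin)
open import Relation.Binary.PropositionalEquality using (_≡_)
open import Function.Bundles using (_↔_)

disc : ℤ → ℤ → ℤ → ℤ
disc n r m = r * r - + 4 * n * m

RSet : (n r m A : ℤ) → Set
RSet n r m A = Σ ℤ λ u → Σ ℤ λ v → Σ ℤ λ w →
  (r * u + m * v + n * w ≡ + 0) × (u * u - v * w ≡ A)

-- Half-integral symmetric matrices σ = (σ1 σ0; σ0 σ2) are encoded by the
-- integer triple (σ1, σ2, s0) with s0 = 2σ0.  The conditions
--   σ1 m - σ0 r + σ2 n = t/2   and   σ0^2 - σ1 σ2 = d/4
-- are multiplied by 2 resp. 4: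
--   2σ1 m - s0 r + 2σ2 n = t   and   s0^2 - 4 σ1 σ2 = d.
NSet : (n r m t d : ℤ) → Set
NSet n r m t d = Σ ℤ λ σ1 → Σ ℤ λ σ2 → Σ ℤ λ s0 →
  (+ 2 * σ1 * m - s0 * r + + 2 * σ2 * n ≡ t) ×
  (s0 * s0 - + 4 * σ1 * σ2 ≡ d)

HasCard : Set → ℕ → Set
HasCard P k = P ↔ Fin k

{-# OPTIONS --safe #-}
module Submission where

open import Defs
open import Data.Nat using (ℕ; _≤_) renaming (_<_ to _<ℕ_)
open import Data.Integer using (ℤ; +_; _+_; _-_; _*_; _<_; ∣_∣)
open import Data.Integer.Divisibility using (_∣_)
open import Data.Product using (_×_)
open import Relation.Nullary using (¬_)
open import Relation.Binary.PropositionalEquality using (_≡_)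

open import Axiom.UniquenessOfIdentityProofs using (module Decidable⇒UIP)
open import Data.Fin.Properties using (injective⇒≤)
open import Data.Integer.Base using (NonZero; >-nonZero)
open import Data.Integer.Divisibility.Signed using (divides; ∣⇒∣ᵤ)
open import Data.Integer.Properties using (_≟_; *-comm; *-cancelˡ-≡; *-cancelʳ-≡)
open import Data.Integer.Tactic.RingSolver using (solve-∀; solve)
open import Data.List using ([]; _∷_)
open import Data.Product using (_,_; proj₁; proj₂)
open import Function using (_∘_)
open import Function.Bundles using (Injection; _↣_; mk↣)
open import Function.Construct.Composition using (_↣-∘_)
open import Function.Construct.Symmetry using (↔-sym)
open import Function.Definitions using (Injective)
open import Function.Properties.Inverse using (↔⇒↣)
open import Relation.Binary.PropositionalEquality using (refl; sym; trans; cong; cong₂; subst)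
open import Relation.Nullary.Negation using (contraposition)

-- The matrix σ = (σ₁, σ₂, s₀ = 2σ₀) is sent to the cross product
--   (u, v, w) = (r, m, n) × (s₀, σ₂, σ₁) = (σ₁ m - σ₂ n, s₀ n - r σ₁, r σ₂ - s₀ m),
-- which lies in 𝔏_T because it is orthogonal to (r, m, n).  The polynomial identity
-- 4 (u² - v w) = t² - D d gives the congruence and shows that the image lies in the
-- set counted by r_T((t² - D d) / 4).  The map is injective since σ is recovered
-- from t, u, v:  σ₁ (4nm - r²) = n t + r v + 2n u,  s₀ n = v + r σ₁,  σ₂ n = σ₁ m - u,
-- and both n and 4nm - r² are nonzero.

HasCard-↣⇒≤ : {P Q : Set} {N k : ℕ} → HasCard P N → HasCard Q k → P ↣ Q → N ≤ k
HasCard-↣⇒≤ P↔N Q↔k P↣Q =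
  injective⇒≤ (Injection.injective (↔⇒↣ Q↔k ↣-∘ (P↣Q ↣-∘ ↔⇒↣ (↔-sym P↔N))))

*-cancelʳ-≡-common : ∀ k {i j l : ℤ} .{{_ : NonZero k}} → i * k ≡ l → j * k ≡ l → i ≡ j
*-cancelʳ-≡-common k {i} {j} ik≡l jk≡l = *-cancelʳ-≡ i j k (trans ik≡l (sym jk≡l))

m∣m*n : ∀ m n → m ∣ m * n
m∣m*n m n = ∣⇒∣ᵤ (divides n (*-comm m n))

NSet-≡ : ∀ {n r m t d σ₁ σ₂ s₀ τ₁ τ₂ s₀′ : ℤ} {eₜ eₜ′ e_d e_d′} →
  σ₁ ≡ τ₁ → σ₂ ≡ τ₂ → s₀ ≡ s₀′ →
  _≡_ {A = NSet n r m t d} (σ₁ , σ₂ , s₀ , eₜ , e_d) (τ₁ , τ₂ , s₀′ , eₜ′ , e_d′)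
NSet-≡ {eₜ = eₜ} {eₜ′} {e_d} {e_d′} refl refl refl =
  cong₂ (λ p q → _ , _ , _ , p , q) (≡-irrelevant eₜ eₜ′) (≡-irrelevant e_d e_d′)
  where open Decidable⇒UIP _≟_ using (≡-irrelevant)

cross-orthogonal : ∀ n r m σ₁ σ₂ s₀ →
  r * (σ₁ * m - σ₂ * n) + m * (s₀ * n - r * σ₁) + n * (r * σ₂ - s₀ * m) ≡ + 0
cross-orthogonal = solve-∀

cross-norm : ∀ n r m σ₁ σ₂ s₀ {t d} →
  + 2 * σ₁ * m - s₀ * r + + 2 * σ₂ * n ≡ t → s₀ * s₀ - + 4 * σ₁ * σ₂ ≡ d →
  + 4 * ((σ₁ * m - σ₂ * n) * (σ₁ * m - σ₂ * n) - (s₀ * n - r * σ₁) * (r * σ₂ - s₀ * m))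
    ≡ t * t - (r * r - + 4 * n * m) * d
cross-norm n r m σ₁ σ₂ s₀ refl refl = solve (n ∷ r ∷ m ∷ σ₁ ∷ σ₂ ∷ s₀ ∷ [])

σ₁-recovery : ∀ n r m σ₁ σ₂ s₀ {t u v} →
  + 2 * σ₁ * m - s₀ * r + + 2 * σ₂ * n ≡ t → σ₁ * m - σ₂ * n ≡ u → s₀ * n - r * σ₁ ≡ v →
  σ₁ * (+ 4 * n * m - r * r) ≡ n * t + r * v + + 2 * n * u
σ₁-recovery n r m σ₁ σ₂ s₀ refl refl refl = solve (n ∷ r ∷ m ∷ σ₁ ∷ σ₂ ∷ s₀ ∷ [])

s₀-recovery : ∀ n r σ₁ s₀ {σ₁′ v} →
  s₀ * n - r * σ₁ ≡ v → σ₁ ≡ σ₁′ → s₀ * n ≡ v + r * σ₁′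
s₀-recovery n r σ₁ s₀ refl refl = solve (n ∷ r ∷ σ₁ ∷ s₀ ∷ [])

σ₂-recovery : ∀ n m σ₁ σ₂ {σ₁′ u} →
  σ₁ * m - σ₂ * n ≡ u → σ₁ ≡ σ₁′ → σ₂ * n ≡ σ₁′ * m - u
σ₂-recovery n m σ₁ σ₂ refl refl = solve (n ∷ m ∷ σ₁ ∷ σ₂ ∷ [])

module _ {n r m t d : ℤ} where

  NSet⇒4∣ : NSet n r m t d → + 4 ∣ t * t - disc n r m * d
  NSet⇒4∣ (σ₁ , σ₂ , s₀ , eₜ , e_d) =
    subst (+ 4 ∣_) (cross-norm n r m σ₁ σ₂ s₀ eₜ e_d) (m∣m*n (+ 4) (u * u - v * w))
    where
    u = σ₁ * m - σ₂ * n
    v = s₀ * n - r * σ₁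
    w = r * σ₂ - s₀ * m

  NSet→RSet : {A : ℤ} → + 4 * A ≡ t * t - disc n r m * d → NSet n r m t d → RSet n r m A
  NSet→RSet 4A≡ (σ₁ , σ₂ , s₀ , eₜ , e_d) =
    σ₁ * m - σ₂ * n , s₀ * n - r * σ₁ , r * σ₂ - s₀ * m ,
    cross-orthogonal n r m σ₁ σ₂ s₀ ,
    *-cancelˡ-≡ (+ 4) _ _ (trans (cross-norm n r m σ₁ σ₂ s₀ eₜ e_d) (sym 4A≡))

  NSet→RSet-injective : .{{_ : NonZero n}} .{{_ : NonZero (+ 4 * n * m - r * r)}} →
    {A : ℤ} (4A≡ : + 4 * A ≡ t * t - disc n r m * d) → Injective _≡_ _≡_ (NSet→RSet 4A≡)
  NSet→RSet-injective _ {σ₁ , σ₂ , s₀ , eₜ , _} {τ₁ , τ₂ , s₀′ , eₜ′ , _} image≡ =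
    NSet-≡ σ₁≡τ₁ σ₂≡τ₂ s₀≡s₀′
    where
    u≡ : σ₁ * m - σ₂ * n ≡ τ₁ * m - τ₂ * n
    u≡ = cong proj₁ image≡
    v≡ : s₀ * n - r * σ₁ ≡ s₀′ * n - r * τ₁
    v≡ = cong (proj₁ ∘ proj₂) image≡
    σ₁≡τ₁ : σ₁ ≡ τ₁
    σ₁≡τ₁ = *-cancelʳ-≡-common (+ 4 * n * m - r * r)
      (σ₁-recovery n r m σ₁ σ₂ s₀ eₜ u≡ v≡) (σ₁-recovery n r m τ₁ τ₂ s₀′ eₜ′ refl refl)
    s₀≡s₀′ : s₀ ≡ s₀′
    s₀≡s₀′ = *-cancelʳ-≡-common n
      (s₀-recovery n r σ₁ s₀ v≡ σ₁≡τ₁) (s₀-recovery n r τ₁ s₀′ refl refl)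
    σ₂≡τ₂ : σ₂ ≡ τ₂
    σ₂≡τ₂ = *-cancelʳ-≡-common n
      (σ₂-recovery n m σ₁ σ₂ u≡ σ₁≡τ₁) (σ₂-recovery n m τ₁ τ₂ refl refl)

lemma3p15 : (M : ℕ) → 0 <ℕ M →
    (n r m : ℤ) →
    ((g : ℤ) → g ∣ n → g ∣ r → g ∣ m → ∣ g ∣ ≡ 1) →
    + 0 < n → + 0 < + 4 * n * m - r * r →
    (t d : ℤ) → + 0 < d →
    (¬ (+ 4 ∣ (t * t - disc n r m * d)) → ¬ NSet n r m t d)
    × ((A : ℤ) → + 4 * A ≡ t * t - disc n r m * d →
        (N k : ℕ) → HasCard (NSet n r m t d) N → HasCard (RSet n r m A) k →
        N ≤ k)
lemma3p15 _ _ n r m _ 0<n 0<4nm-r² t d _ =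
  contraposition NSet⇒4∣ ,
  λ A 4A≡ N k NSet↔N RSet↔k →
    HasCard-↣⇒≤ NSet↔N RSet↔k (mk↣ (NSet→RSet-injective 4A≡))
  where
  instance
    n≢0 : NonZero n
    n≢0 = >-nonZero 0<n
    4nm-r²≢0 : NonZero (+ 4 * n * m - r * r)
    4nm-r²≢0 = >-nonZero 0<4nm-r²
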